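{- A set $S\subseteq\mathbb{Z}^+$ is a $^+1$-monoid if and only if (1) $1\in S$, and (2) for all $s_1,s_2\in S$, $s_1+s_2-1\in S$.
   Context: A set $S\subseteq\mathbb{Z}^+$ is a $^+1$-monoid if (1) $1\in S$, and (2) for every $\ell\in S$ and every sequence $s_1,\dots,s_\ell$ of elements of $S$, the sum $\sum_{j=1}^\ell s_j$ lies in $S$. -}

module Defs where

open import Data.Nat using (ℕ; _≤_)
open import Data.Fin using (Fin)
open import Data.Product using (_×_)
open import Data.Vec.Functional using (Vector; foldr)
open import Data.Nat using (_+_)

PosSubset : (ℕ → Set) → Set
PosSubset S = ∀ n → S n → 1 ≤ n

sumSeq : ∀ {ℓ} → Vector ℕ ℓ → ℕ
sumSeq = foldr _+_ 0

IsPlus1Monoid : (ℕ → Set) → Set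
IsPlus1Monoid S =
  S 1 ×
  (∀ (ℓ : ℕ) → S ℓ → (s : Fin ℓ → ℕ) → (∀ j → S (s j)) → S (sumSeq s))

module Submission where

-- (⇒)  For s₁ = k + 1 ∈ S and s₂ ∈ S, the sequence (s₂, 1, …, 1) of length
--      s₁ consists of elements of S, so its sum s₂ + k = s₁ ⊕ s₂ lies in S.
-- (⇐)  For a nonempty sequence s₀, …, s_k of elements of S, fold it with ⊕
--      into its shifted sum  s₀ ⊕ (s₁ ⊕ (… ⊕ s_k)).  Closure under ⊕ puts the
--      shifted sum in S, and positivity of the entries makes each ⊕ lose
--      exactly 1, so  s₀ + … + s_k = (shifted sum) + k.  Given ℓ = k + 1 ∈ S,
--      the sum of a sequence of length ℓ is then ℓ ⊕ (shifted sum) ∈ S.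

open import Defs
open import Data.Nat using (ℕ; _+_; _∸_; _≤_; zero; suc; s≤s)
open import Data.Nat.Properties using (+-comm; +-assoc; +-suc)
open import Data.Fin using (Fin)
open import Data.Product using (_×_; _,_; proj₁)
open import Data.Vec.Functional using (Vector; _∷_; head; tail; replicate)
open import Function.Bundles using (_⇔_; mk⇔)
open import Relation.Binary.PropositionalEquality using (_≡_; refl; cong; sym; trans; subst; module ≡-Reasoning)

_⊕_ : ℕ → ℕ → ℕ
a ⊕ b = a + b ∸ 1

ClosedUnder⊕ : (ℕ → Set) → Set
ClosedUnder⊕ S = ∀ s₁ s₂ → S s₁ → S s₂ → S (s₁ ⊕ s₂)

AllIn : (ℕ → Set) → ∀ {n} → Vector ℕ n → Set
AllIn S s = ∀ j → S (s j)

⊕-+-suc : ∀ {a} b c → 1 ≤ a → (a ⊕ b) + suc c ≡ a + (b + c)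
⊕-+-suc {suc a} b c (s≤s _) = begin
  a + b + suc c    ≡⟨ +-suc (a + b) c ⟩
  suc (a + b + c)  ≡⟨ cong suc (+-assoc a b c) ⟩
  suc (a + (b + c)) ∎
  where open ≡-Reasoning

shiftedSum : ∀ {k} → Vector ℕ (suc k) → ℕ
shiftedSum {zero}  s = head s
shiftedSum {suc k} s = head s ⊕ shiftedSum (tail s)

shiftedSum-∈ : ∀ {S k} → ClosedUnder⊕ S →
  (s : Vector ℕ (suc k)) → AllIn S s → S (shiftedSum s)
shiftedSum-∈ {k = zero}  closed s s∈S = s∈S Fin.zero
shiftedSum-∈ {k = suc k} closed s s∈S =
  closed _ _ (s∈S Fin.zero) (shiftedSum-∈ closed (tail s) (λ j → s∈S (Fin.suc j)))

sumSeq-shiftedSum : ∀ {k} (s : Vector ℕ (suc k)) → (∀ j → 1 ≤ s j) →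
  sumSeq s ≡ shiftedSum s + k
sumSeq-shiftedSum {zero}  s pos = refl
sumSeq-shiftedSum {suc k} s pos = begin
  head s + sumSeq (tail s)                 ≡⟨ cong (head s +_) (sumSeq-shiftedSum (tail s) (λ j → pos (Fin.suc j))) ⟩
  head s + (shiftedSum (tail s) + k)       ≡⟨ sym (⊕-+-suc (shiftedSum (tail s)) k (pos Fin.zero)) ⟩
  (head s ⊕ shiftedSum (tail s)) + suc k   ∎
  where open ≡-Reasoning

sumSeq-ones : ∀ k → sumSeq (replicate k 1) ≡ k
sumSeq-ones zero    = refl
sumSeq-ones (suc k) = cong suc (sumSeq-ones k)

sumSeq-padWithOnes : ∀ k b → sumSeq (b ∷ replicate k 1) ≡ k + b
sumSeq-padWithOnes k b = trans (cong (b +_) (sumSeq-ones k)) (+-comm b k)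

monoid⇒closedUnder⊕ : ∀ {S} → PosSubset S → IsPlus1Monoid S → ClosedUnder⊕ S
monoid⇒closedUnder⊕ pos _ zero _ 0∈S _ with () ← pos zero 0∈S
monoid⇒closedUnder⊕ {S} pos (1∈S , sums∈S) (suc k) b k+1∈S b∈S =
  subst S (sumSeq-padWithOnes k b) (sums∈S (suc k) k+1∈S (b ∷ replicate k 1) entries∈S)
  where
  entries∈S : AllIn S (b ∷ replicate k 1)
  entries∈S Fin.zero    = b∈S
  entries∈S (Fin.suc _) = 1∈S

closedUnder⊕⇒sums∈ : ∀ {S} → PosSubset S → ClosedUnder⊕ S →
  ∀ ℓ → S ℓ → (s : Vector ℕ ℓ) → AllIn S s → S (sumSeq s)
closedUnder⊕⇒sums∈ pos _ zero 0∈S _ _ with () ← pos zero 0∈S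
closedUnder⊕⇒sums∈ {S} pos closed (suc k) ℓ∈S s s∈S =
  subst S sum≡ (closed (suc k) (shiftedSum s) ℓ∈S (shiftedSum-∈ closed s s∈S))
  where
  sum≡ : k + shiftedSum s ≡ sumSeq s
  sum≡ = trans (+-comm k (shiftedSum s))
               (sym (sumSeq-shiftedSum s (λ j → pos (s j) (s∈S j))))

lemma5p4 : (S : ℕ → Set) → PosSubset S →
    IsPlus1Monoid S ⇔ (S 1 × (∀ s₁ s₂ → S s₁ → S s₂ → S (s₁ + s₂ ∸ 1)))
lemma5p4 S pos = mk⇔
  (λ monoid → proj₁ monoid , monoid⇒closedUnder⊕ pos monoid)
  (λ { (1∈S , closed) → 1∈S , closedUnder⊕⇒sums∈ pos closed })
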